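{- Let $G$ be a set of $n$ elements with binary operations $+,\cdot$ such that $(G,+)$ and $(G,\cdot)$ are both groups. Let $S_a$ be a basis of $(G,+)$ and $S_m$ a basis of $(G,\cdot)$. Then the following are equivalent: (1) $a\cdot(b+c)=a\cdot b+a\cdot c$ for all $a,b,c\in G$; (2) $x\cdot(y+z)=x\cdot y+x\cdot z$ for all $x\in S_m$, $y\in S_a$, $z\in G$.
   Context: A basis of a group $(G,\ast)$ is a subset $S\subseteq G$ such that every $g\in G$ can be written as $g=\alpha\ast\beta$ with $\alpha,\beta\in S$. -}

module Defs where

open import Data.Product using (Σ; ∃; ∃-syntax; _×_; _,_)
open import Relation.Binary.PropositionalEquality using (_≡_)

IsBasis : {G : Set} → (G → G → G) → (G → Set) → Set
IsBasis {G} _∗_ S = ∀ (g : G) → ∃[ α ] ∃[ β ] (S α × S β × g ≡ α ∗ β)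

-- The elements x for which y ↦ x · y is additive are closed under ·, so it
-- suffices that every element of Sm is additive; and additivity of y ↦ x · y
-- on sums y + z with y ∈ Sa extends to all y, since every y is a sum of two
-- elements of Sa and + is associative.
module Submission where

open import Defs
open import Data.Nat using (ℕ)
open import Data.Fin using (Fin)
open import Data.Product using (_,_)
open import Function.Bundles using (_↔_; _⇔_; mk⇔)
open import Relation.Binary.PropositionalEquality
  using (_≡_; refl; sym; cong; cong₂; module ≡-Reasoning)
open import Algebra.Definitions using (Associative)
open import Algebra.Structures using (IsGroup)

module _ {G : Set} (_+_ _·_ : G → G → G) where

  DistribˡAt : G → Set
  DistribˡAt x = ∀ y z → x · (y + z) ≡ (x · y) + (x · z)

  distribˡAt-fromBasis : Associative _≡_ _+_ → (Sa : G → Set) → IsBasis _+_ Sa →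
                         ∀ x → (∀ y z → Sa y → x · (y + z) ≡ (x · y) + (x · z)) →
                         DistribˡAt x
  distribˡAt-fromBasis +-assoc Sa basis x h y z with basis y
  ... | y₁ , y₂ , y₁∈Sa , y₂∈Sa , refl = begin
    x · ((y₁ + y₂) + z)                ≡⟨ cong (x ·_) (+-assoc y₁ y₂ z) ⟩
    x · (y₁ + (y₂ + z))                ≡⟨ h y₁ (y₂ + z) y₁∈Sa ⟩
    (x · y₁) + (x · (y₂ + z))          ≡⟨ cong ((x · y₁) +_) (h y₂ z y₂∈Sa) ⟩
    (x · y₁) + ((x · y₂) + (x · z))    ≡⟨ sym (+-assoc _ _ _) ⟩
    ((x · y₁) + (x · y₂)) + (x · z)    ≡⟨ cong (_+ (x · z)) (sym (h y₁ y₂ y₁∈Sa)) ⟩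
    (x · (y₁ + y₂)) + (x · z)          ∎
    where open ≡-Reasoning

  distribˡAt-· : Associative _≡_ _·_ → ∀ x₁ x₂ →
                 DistribˡAt x₁ → DistribˡAt x₂ → DistribˡAt (x₁ · x₂)
  distribˡAt-· ·-assoc x₁ x₂ d₁ d₂ y z = begin
    (x₁ · x₂) · (y + z)                ≡⟨ ·-assoc x₁ x₂ (y + z) ⟩
    x₁ · (x₂ · (y + z))                ≡⟨ cong (x₁ ·_) (d₂ y z) ⟩
    x₁ · ((x₂ · y) + (x₂ · z))         ≡⟨ d₁ _ _ ⟩
    (x₁ · (x₂ · y)) + (x₁ · (x₂ · z))  ≡⟨ sym (cong₂ _+_ (·-assoc x₁ x₂ y) (·-assoc x₁ x₂ z)) ⟩
    ((x₁ · x₂) · y) + ((x₁ · x₂) · z)  ∎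
    where open ≡-Reasoning

  distribˡ-fromBases : Associative _≡_ _+_ → Associative _≡_ _·_ →
                          (Sa Sm : G → Set) → IsBasis _+_ Sa → IsBasis _·_ Sm →
                          (∀ x y z → Sm x → Sa y → x · (y + z) ≡ (x · y) + (x · z)) →
                          ∀ a → DistribˡAt a
  distribˡ-fromBases +-assoc ·-assoc Sa Sm basisₐ basisₘ h a with basisₘ a
  ... | x₁ , x₂ , x₁∈Sm , x₂∈Sm , refl =
    distribˡAt-· ·-assoc x₁ x₂ (onSm x₁ x₁∈Sm) (onSm x₂ x₂∈Sm)
    where
    onSm : ∀ x → Sm x → DistribˡAt x
    onSm x x∈Sm = distribˡAt-fromBasis +-assoc Sa basisₐ x (λ y z → h x y z x∈Sm)

lemma9p3 : (n : ℕ) (G : Set) → G ↔ Fin n →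
           (_+_ : G → G → G) (0# : G) (-_ : G → G) → IsGroup _≡_ _+_ 0# -_ →
           (_·_ : G → G → G) (1# : G) (_⁻¹ : G → G) → IsGroup _≡_ _·_ 1# _⁻¹ →
           (Sa Sm : G → Set) → IsBasis _+_ Sa → IsBasis _·_ Sm →
           ((∀ a b c → a · (b + c) ≡ (a · b) + (a · c))
             ⇔ (∀ x y z → Sm x → Sa y → x · (y + z) ≡ (x · y) + (x · z)))
lemma9p3 _ _ _ _+_ _ _ +-group _·_ _ _ ·-group Sa Sm basisₐ basisₘ =
  mk⇔ (λ d x y z _ _ → d x y z)
      (distribˡ-fromBases _+_ _·_ (IsGroup.assoc +-group) (IsGroup.assoc ·-group)
                             Sa Sm basisₐ basisₘ)
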